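{- Let $p$ be an odd prime and $N$ a prime with $p\mid N-1$; put $M=\frac{N-1}{p}$. For integers $j\ge0$ let $S_j=\prod_{k=1}^{p-1}((Mk)!)^{k^j}$, and for integers $m$ let $A_m=\prod_{k=1}^{N-1}k^{k^m}$. If $0<m<p-1$, then $$A_m=\prod_{j=1}^{m-1}S_j^{(-1)^j\binom{m}{j}}\quad\text{in } \mathbf{F}_N^\times/\mathbf{F}_N^{\times p}.$$ -}

module Defs where

open import Data.Bool using (Bool; true; false; if_then_else_)
open import Data.Nat using (ℕ; zero; suc; _+_; _*_; _∸_; _^_; _!)
open import Data.Nat.Combinatorics using (_C_)
open import Data.Integer using (ℤ; +_; _-_)
import Data.Integer.Divisibility as ℤD
import Data.Nat.Divisibility as ℕD
open import Data.Product using (∃; _×_)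
open import Relation.Nullary using (¬_)

prodFrom : (ℕ → ℕ) → ℕ → ℕ → ℕ
prodFrom f a zero      = 1
prodFrom f a (suc len) = f a * prodFrom f (suc a) len

prod1 : ℕ → (ℕ → ℕ) → ℕ
prod1 n f = prodFrom f 1 n

S : (p M j : ℕ) → ℕ
S p M j = prod1 (p ∸ 1) (λ k → ((M * k) !) ^ (k ^ j))

A : (N m : ℕ) → ℕ
A N m = prod1 (N ∸ 1) (λ k → k ^ (k ^ m))

isEven : ℕ → Bool
isEven zero          = true
isEven (suc zero)    = false
isEven (suc (suc n)) = isEven n

-- The product ∏_{j=1}^{m-1} S_j^{(-1)^j C(m,j)} is the quotient posPart / negPart:
-- posPart = ∏_{j=1, j even}^{m-1} S_j^{C(m,j)},  negPart = ∏_{j=1, j odd}^{m-1} S_j^{C(m,j)}.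
posPart : (p M m : ℕ) → ℕ
posPart p M m = prod1 (m ∸ 1) (λ j → if isEven j then S p M j ^ (m C j) else 1)

negPart : (p M m : ℕ) → ℕ
negPart p M m = prod1 (m ∸ 1) (λ j → if isEven j then 1 else S p M j ^ (m C j))

CongMod : ℕ → ℕ → ℕ → Set
CongMod N a b = (+ N) ℤD.∣ (+ a - + b)

EqModPthPowers : (p N a b : ℕ) → Set
EqModPthPowers p N a b = ∃ λ c → ¬ (N ℕD.∣ c) × CongMod N (a * c ^ p) b

module Submission where

-- Write F r = (M r)!, so that S_j = ∏_{r=1}^{p-1} F(r)^{r^j}, and x ≈ y for
-- equality in F_N^× / (F_N^×)^p.  The argument follows the paper.
--  * Grouping 1, …, N - 1 by their residue r modulo p and reducing exponents modulo p
--    gives A_m ≈ ∏_r P(r)^{r^m}, where P(r) = ∏_{q<M} (p q + r).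
--  * As M (p q + r) ≡ M r - q (mod N), M^M P(r) F(r - 1) ≡ F(r).
--  * For 0 < m < p - 1 the prime p divides ∑_{r=1}^{p-1} r^m, so the powers of M^M
--    drop out and A_m ∏_r F(r - 1)^{r^m} ≈ S_m.
--  * The binomial theorem in the exponent rewrites ∏_r F(r - 1)^{r^m} as ∏_{j≤m} S_j^{C(m,j)}.
--  * Wilson's theorem and -1 ≈ 1 give F(r) F(p - r) ≈ 1, hence S_j ≈ 1 for even j.
-- Cancelling S_m leaves A_m ∏_{j odd} S_j^{C(m,j)} ≈ 1 ≈ ∏_{j even} S_j^{C(m,j)}.

open import Level using (0ℓ)
open import Function using (_∘_)
open import Data.Bool using (true; false; if_then_else_)
open import Data.Empty using (⊥-elim)
open import Data.Product using (Σ; _,_; proj₁; proj₂)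
open import Data.Sum using (inj₁; inj₂)
open import Data.Nat using (ℕ; zero; suc; _+_; _*_; _∸_; _^_; _≤_; _<_; _!; s≤s; z≤n; nonTrivial⇒n>1; >-nonZero)
import Data.Nat.Properties as ℕ
open import Data.Nat.Divisibility using (_∣_; divides; _∣0; ∣-refl; ∣m⇒∣m*n; ∣n⇒∣m*n; ∣m∣n⇒∣m+n; ∣m+n∣m⇒∣n; ∣⇒≤; >⇒∤; m%n≡0⇒n∣m)
open import Data.Nat.DivMod using (_%_; _/_; m≡m%n+[m/n]*n; m%n<n)
open import Data.Nat.Combinatorics using (_C_; nCn≡1; nC1≡n; nCk≡nC[n∸k])
open import Data.Nat.Primality using (Prime; euclidsLemma; prime⇒irreducible; prime⇒nonTrivial; ¬prime[0])
open import Data.Nat.Coprimality using (Coprime; coprime-Bézout)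
open import Data.Nat.GCD using (module Bézout)
open import Data.Nat.Induction using (<-rec)
open import Data.Nat.Tactic.RingSolver using (solve-∀)
import Data.Integer as ℤ
import Data.Integer.Properties as ℤ
import Data.Integer.Divisibility.Signed as ℤ
open import Data.Integer.Tactic.RingSolver using () renaming (solve-∀ to ℤ-solve-∀)
open import Data.Fin using (Fin; toℕ; fromℕ<)
import Data.Fin.Properties as Fin
open import Data.Fin.Permutation using (permutation; Permutation′)
open import Relation.Nullary using (¬_)
open import Relation.Binary.PropositionalEquality
open import Relation.Binary.Bundles using (Setoid)
open import Relation.Binary.Structures using (IsEquivalence)
import Relation.Binary.Reasoning.Setoid as SetoidReasoning
import Algebra.Properties.CommutativeSemigroup ℕ.*-commutativeSemigroup as *-Comm
import Algebra.Properties.CommutativeSemigroup ℕ.+-commutativeSemigroup as +-Comm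
import Algebra.Properties.CommutativeMonoid.Sum ℕ.*-1-commutativeMonoid as FinProduct
import Algebra.Properties.CommutativeSemiring.Binomial ℕ.+-*-commutativeSemiring as Binomial
import Algebra.Properties.Semiring.Exp ℕ.+-*-semiring as SemiringExp
import Algebra.Properties.Semiring.Mult ℕ.+-*-semiring as SemiringMult
import Algebra.Properties.Semiring.Sum ℕ.+-*-semiring as SemiringSum
open import Defs

module Congruence where

  open import Data.Integer using (+_)

  -- a ≡ b (mod n) for natural numbers: n divides a - b in ℤ.  Packaged as
  -- a record so that a and b can be recovered from the type by unification.
  infix 4 _≡_mod_
  record _≡_mod_ (a b n : ℕ) : Set where
    constructor mod-intro
    field n∣a-b : (+ n) ℤ.∣ (+ a ℤ.- + b)

  open _≡_mod_ public

  ≡-mod⇒CongMod : ∀ {n a b} → a ≡ b mod n → CongMod n a b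
  ≡-mod⇒CongMod c = ℤ.∣⇒∣ᵤ (n∣a-b c)

  module _ {n : ℕ} where

    ≡-mod-refl : ∀ {a} → a ≡ a mod n
    ≡-mod-refl {a} = mod-intro (ℤ.divides (+ 0) (ℤ.+-inverseʳ (+ a)))

    ≡⇒≡-mod : ∀ {a b} → a ≡ b → a ≡ b mod n
    ≡⇒≡-mod refl = ≡-mod-refl

    ≡-mod-sym : ∀ {a b} → a ≡ b mod n → b ≡ a mod n
    ≡-mod-sym {a} {b} (mod-intro d) = mod-intro (subst ((+ n) ℤ.∣_) (negate (+ a) (+ b)) (ℤ.∣m⇒∣-m d))
      where negate : ∀ x y → ℤ.- (x ℤ.- y) ≡ y ℤ.- x
            negate = ℤ-solve-∀

    ≡-mod-trans : ∀ {a b c} → a ≡ b mod n → b ≡ c mod n → a ≡ c mod n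
    ≡-mod-trans {a} {b} {c} (mod-intro d) (mod-intro d′) =
      mod-intro (subst ((+ n) ℤ.∣_) (telescope (+ a) (+ b) (+ c)) (ℤ.∣m∣n⇒∣m+n d d′))
      where telescope : ∀ x y z → (x ℤ.- y) ℤ.+ (y ℤ.- z) ≡ x ℤ.- z
            telescope = ℤ-solve-∀

    ≡-mod-isEquivalence : IsEquivalence (λ a b → a ≡ b mod n)
    ≡-mod-isEquivalence = record { refl = ≡-mod-refl ; sym = ≡-mod-sym ; trans = ≡-mod-trans }

    -- ac - bd = c(a - b) + b(c - d).
    *-cong-mod : ∀ {a b c d} → a ≡ b mod n → c ≡ d mod n → a * c ≡ b * d mod n
    *-cong-mod {a} {b} {c} {d} (mod-intro d₁) (mod-intro d₂) =
      mod-intro (subst ((+ n) ℤ.∣_) difference (ℤ.∣m∣n⇒∣m+n (ℤ.∣n⇒∣m*n (+ c) d₁) (ℤ.∣n⇒∣m*n (+ b) d₂)))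
      where
      expand : ∀ x y z w → z ℤ.* (x ℤ.- y) ℤ.+ y ℤ.* (z ℤ.- w) ≡ x ℤ.* z ℤ.- y ℤ.* w
      expand = ℤ-solve-∀
      difference : + c ℤ.* (+ a ℤ.- + b) ℤ.+ + b ℤ.* (+ c ℤ.- + d) ≡ + (a * c) ℤ.- + (b * d)
      difference = trans (expand (+ a) (+ b) (+ c) (+ d)) (sym (cong₂ ℤ._-_ (ℤ.pos-* a c) (ℤ.pos-* b d)))

    ^-cong-mod : ∀ {a b} e → a ≡ b mod n → a ^ e ≡ b ^ e mod n
    ^-cong-mod zero    _ = ≡-mod-refl
    ^-cong-mod (suc e) c = *-cong-mod c (^-cong-mod e c)

    +-multiple : ∀ b k → b + k * n ≡ b mod n
    +-multiple b k = mod-intro (ℤ.divides (+ k) difference)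
      where
      cancel : ∀ x y → (x ℤ.+ y) ℤ.- x ≡ y
      cancel = ℤ-solve-∀
      difference : + (b + k * n) ℤ.- + b ≡ + k ℤ.* + n
      difference = trans (cong (λ z → (+ b ℤ.+ z) ℤ.- + b) (ℤ.pos-* k n)) (cancel (+ b) (+ k ℤ.* + n))

    ≡-mod-by-multiples : ∀ {a b} x y → a + x * n ≡ b + y * n → a ≡ b mod n
    ≡-mod-by-multiples {a} {b} x y e =
      ≡-mod-trans (≡-mod-sym (+-multiple a x)) (subst (_≡ b mod n) (sym e) (+-multiple b y))

    +-≡-mod⇒∣ : ∀ {a k} → a + k ≡ a mod n → n ∣ k
    +-≡-mod⇒∣ {a} {k} (mod-intro d) = ℤ.∣⇒∣ᵤ (subst ((+ n) ℤ.∣_) (cancel (+ a) (+ k)) d)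
      where cancel : ∀ x y → (x ℤ.+ y) ℤ.- x ≡ y
            cancel = ℤ-solve-∀

    ∣⇒≡-mod-0 : ∀ {x} → n ∣ x → x ≡ 0 mod n
    ∣⇒≡-mod-0 (divides q refl) = +-multiple 0 q

    ≡-mod-0⇒∣ : ∀ {x} → x ≡ 0 mod n → n ∣ x
    ≡-mod-0⇒∣ {x} c = +-≡-mod⇒∣ {0} {x} c

  ≡-mod-setoid : ℕ → Setoid 0ℓ 0ℓ
  ≡-mod-setoid n = record { Carrier = ℕ ; _≈_ = _≡_mod n ; isEquivalence = ≡-mod-isEquivalence {n} }

  module ≡-mod-Reasoning (n : ℕ) = SetoidReasoning (≡-mod-setoid n)

  -- (-1)² ≡ 1 modulo every positive modulus k + 1.
  square-of-predecessor : ∀ k → k * k ≡ 1 mod suc k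
  square-of-predecessor zero    = ≡-mod-by-multiples 1 0 refl
  square-of-predecessor (suc k) = ≡-mod-by-multiples 0 k (expand k)
    where expand : ∀ k → suc k * suc k + 0 * suc (suc k) ≡ 1 + k * suc (suc k)
          expand = solve-∀

  -- k - q ≡ (-1)(q + 1) = k (q + 1) modulo k + 1.
  ∸≡*suc : ∀ {k q} → q ≤ k → k ∸ q ≡ k * suc q mod suc k
  ∸≡*suc {k} {q} q≤k = ≡-mod-by-multiples q 0 (begin
    k ∸ q + q * suc k    ≡⟨ cong (λ t → k ∸ q + t) (ℕ.*-suc q k) ⟩
    k ∸ q + (q + q * k)  ≡˘⟨ ℕ.+-assoc (k ∸ q) q (q * k) ⟩
    k ∸ q + q + q * k    ≡⟨ cong₂ _+_ (ℕ.m∸n+n≡m q≤k) (ℕ.*-comm q k) ⟩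
    k + k * q            ≡˘⟨ ℕ.*-suc k q ⟩
    k * suc q            ≡˘⟨ ℕ.+-identityʳ (k * suc q) ⟩
    k * suc q + 0 * suc k ∎)
    where open ≡-Reasoning

  ∏-cong-mod : ∀ {n m} (f g : Fin m → ℕ) → (∀ i → f i ≡ g i mod n) → FinProduct.sum f ≡ FinProduct.sum g mod n
  ∏-cong-mod {m = zero}  f g f≡g = ≡-mod-refl
  ∏-cong-mod {m = suc m} f g f≡g = *-cong-mod (f≡g Fin.zero) (∏-cong-mod (λ i → f (Fin.suc i)) (λ i → g (Fin.suc i)) (λ i → f≡g (Fin.suc i)))

module Ranges where

  open ≡-Reasoning

  sumFrom : (ℕ → ℕ) → ℕ → ℕ → ℕ
  sumFrom f a zero    = 0
  sumFrom f a (suc n) = f a + sumFrom f (suc a) n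

  ^-distribʳ-* : ∀ x y e → (x * y) ^ e ≡ x ^ e * y ^ e
  ^-distribʳ-* x y zero    = refl
  ^-distribʳ-* x y (suc e) = trans (cong (x * y *_) (^-distribʳ-* x y e)) (*-Comm.interchange x y (x ^ e) (y ^ e))

  prod-cong : ∀ {f g} a n → (∀ i → f i ≡ g i) → prodFrom f a n ≡ prodFrom g a n
  prod-cong a zero    f≗g = refl
  prod-cong a (suc n) f≗g = cong₂ _*_ (f≗g a) (prod-cong (suc a) n f≗g)

  prod-* : ∀ f g a n → prodFrom (λ i → f i * g i) a n ≡ prodFrom f a n * prodFrom g a n
  prod-* f g a zero    = refl
  prod-* f g a (suc n) = begin
    f a * g a * prodFrom (λ i → f i * g i) (suc a) n   ≡⟨ cong (f a * g a *_) (prod-* f g (suc a) n) ⟩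
    f a * g a * (prodFrom f (suc a) n * prodFrom g (suc a) n) ≡⟨ *-Comm.interchange (f a) (g a) _ _ ⟩
    f a * prodFrom f (suc a) n * (g a * prodFrom g (suc a) n) ∎

  prod-const : ∀ c a n → prodFrom (λ _ → c) a n ≡ c ^ n
  prod-const c a zero    = refl
  prod-const c a (suc n) = cong (c *_) (prod-const c (suc a) n)

  prod-one : ∀ a n → prodFrom (λ _ → 1) a n ≡ 1
  prod-one a n = trans (prod-const 1 a n) (ℕ.^-zeroˡ n)

  prod-^ : ∀ f e a n → prodFrom (λ i → f i ^ e) a n ≡ prodFrom f a n ^ e
  prod-^ f e a zero    = sym (ℕ.^-zeroˡ e)
  prod-^ f e a (suc n) = trans (cong (f a ^ e *_) (prod-^ f e (suc a) n)) (sym (^-distribʳ-* (f a) _ e))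

  prod-^-sum : ∀ x g a n → prodFrom (λ i → x ^ g i) a n ≡ x ^ sumFrom g a n
  prod-^-sum x g a zero    = refl
  prod-^-sum x g a (suc n) = trans (cong (x ^ g a *_) (prod-^-sum x g (suc a) n)) (sym (ℕ.^-distribˡ-+-* x (g a) _))

  prod-shift : ∀ f c a n → prodFrom f (c + a) n ≡ prodFrom (λ i → f (c + i)) a n
  prod-shift f c a zero    = refl
  prod-shift f c a (suc n) =
    cong (f (c + a) *_) (trans (cong (λ b → prodFrom f b n) (sym (ℕ.+-suc c a))) (prod-shift f c (suc a) n))

  prod-split : ∀ f a m n → prodFrom f a (m + n) ≡ prodFrom f a m * prodFrom f (a + m) n
  prod-split f a zero    n = trans (cong (λ b → prodFrom f b n) (sym (ℕ.+-identityʳ a))) (sym (ℕ.*-identityˡ _))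
  prod-split f a (suc m) n = begin
    f a * prodFrom f (suc a) (m + n)                      ≡⟨ cong (f a *_) (prod-split f (suc a) m n) ⟩
    f a * (prodFrom f (suc a) m * prodFrom f (suc a + m) n) ≡⟨ cong (λ b → f a * (prodFrom f (suc a) m * prodFrom f b n)) (sym (ℕ.+-suc a m)) ⟩
    f a * (prodFrom f (suc a) m * prodFrom f (a + suc m) n) ≡⟨ sym (ℕ.*-assoc (f a) _ _) ⟩
    f a * prodFrom f (suc a) m * prodFrom f (a + suc m) n   ∎

  prod-last : ∀ f a n → prodFrom f a (suc n) ≡ prodFrom f a n * f (a + n)
  prod-last f a n = begin
    prodFrom f a (suc n)                   ≡⟨ cong (prodFrom f a) (ℕ.+-comm 1 n) ⟩
    prodFrom f a (n + 1)                   ≡⟨ prod-split f a n 1 ⟩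
    prodFrom f a n * (f (a + n) * 1)       ≡⟨ cong (prodFrom f a n *_) (ℕ.*-identityʳ _) ⟩
    prodFrom f a n * f (a + n)             ∎

  prod-swap : ∀ (f : ℕ → ℕ → ℕ) a n b m →
              prodFrom (λ i → prodFrom (f i) b m) a n ≡ prodFrom (λ j → prodFrom (λ i → f i j) a n) b m
  prod-swap f a zero    b m = sym (prod-one b m)
  prod-swap f a (suc n) b m = trans (cong (prodFrom (f a) b m *_) (prod-swap f (suc a) n b m))
                                    (sym (prod-* (f a) (λ j → prodFrom (λ i → f i j) (suc a) n) b m))

  prod-blocks : ∀ f a M p → prodFrom f a (M * p) ≡ prodFrom (λ q → prodFrom f (a + p * q) p) 0 M
  prod-blocks f a zero    p = refl
  prod-blocks f a (suc M) p = begin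
    prodFrom f a (p + M * p)                                       ≡⟨ prod-split f a p (M * p) ⟩
    prodFrom f a p * prodFrom f (a + p) (M * p)                     ≡⟨ cong₂ _*_ (cong (λ b → prodFrom f b p) first-block)
                                                                               (prod-blocks f (a + p) M p) ⟩
    prodFrom f (a + p * 0) p * prodFrom (λ q → prodFrom f (a + p + p * q) p) 0 M
                                                                    ≡⟨ cong (prodFrom f (a + p * 0) p *_)
                                                                         (trans (prod-cong 0 M (λ q → cong (λ b → prodFrom f b p) (next-block q)))
                                                                                (sym (prod-shift _ 1 0 M))) ⟩
    prodFrom f (a + p * 0) p * prodFrom (λ q → prodFrom f (a + p * q) p) 1 M ∎
    where
    first-block : a ≡ a + p * 0
    first-block = sym (trans (cong (a +_) (ℕ.*-zeroʳ p)) (ℕ.+-identityʳ a))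
    next-block : ∀ q → a + p + p * q ≡ a + p * suc q
    next-block q = trans (ℕ.+-assoc a p (p * q)) (cong (a +_) (sym (ℕ.*-suc p q)))

  prod-reverse : ∀ f n → prodFrom f 1 n ≡ prodFrom (λ i → f (suc n ∸ i)) 1 n
  prod-reverse f zero    = refl
  prod-reverse f (suc n) = begin
    prodFrom f 1 (suc n)                              ≡⟨ prod-last f 1 n ⟩
    prodFrom f 1 n * f (suc n)                        ≡⟨ ℕ.*-comm _ (f (suc n)) ⟩
    f (suc n) * prodFrom f 1 n                        ≡⟨ cong (f (suc n) *_) (prod-reverse f n) ⟩
    f (suc n) * prodFrom (λ i → f (suc n ∸ i)) 1 n    ≡⟨ cong (f (suc n) *_) (sym (prod-shift _ 1 1 n)) ⟩
    f (suc n) * prodFrom (λ i → f (suc (suc n) ∸ i)) 2 n ∎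

  prod-identity≡! : ∀ n → prodFrom (λ k → k) 1 n ≡ n !
  prod-identity≡! zero    = refl
  prod-identity≡! (suc n) = begin
    prodFrom (λ k → k) 1 (suc n)  ≡⟨ prod-last (λ k → k) 1 n ⟩
    prodFrom (λ k → k) 1 n * suc n ≡⟨ cong (_* suc n) (prod-identity≡! n) ⟩
    n ! * suc n                    ≡⟨ ℕ.*-comm (n !) (suc n) ⟩
    suc n * n !                    ∎

  !-split : ∀ a L → (a + L) ! ≡ a ! * prodFrom (λ q → a + L ∸ q) 0 L
  !-split a zero    = trans (cong _! (ℕ.+-identityʳ a)) (sym (ℕ.*-identityʳ (a !)))
  !-split a (suc L) = begin
    (a + suc L) !                                        ≡⟨ cong _! (ℕ.+-suc a L) ⟩
    suc (a + L) * (a + L) !                              ≡⟨ cong (suc (a + L) *_) (!-split a L) ⟩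
    suc (a + L) * (a ! * prodFrom (λ q → a + L ∸ q) 0 L) ≡⟨ *-Comm.x∙yz≈y∙xz (suc (a + L)) (a !) _ ⟩
    a ! * (suc (a + L) * prodFrom (λ q → a + L ∸ q) 0 L) ≡⟨ cong (a ! *_) (cong₂ _*_ (cong (_∸ 0) (sym (ℕ.+-suc a L))) shifted) ⟩
    a ! * prodFrom (λ q → a + suc L ∸ q) 0 (suc L)       ∎
    where
    shifted : prodFrom (λ q → a + L ∸ q) 0 L ≡ prodFrom (λ q → a + suc L ∸ q) 1 L
    shifted = trans (prod-cong 0 L (λ q → cong (_∸ suc q) (sym (ℕ.+-suc a L)))) (sym (prod-shift _ 1 0 L))

  prodFrom≡∏ : ∀ g m → prodFrom g 0 m ≡ FinProduct.sum {m} (λ i → g (toℕ i))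
  prodFrom≡∏ g zero    = refl
  prodFrom≡∏ g (suc m) = cong (g 0 *_) (trans (prod-shift g 1 0 m) (prodFrom≡∏ (λ i → g (suc i)) m))

  sum-cong : ∀ {f g} a n → (∀ i → f i ≡ g i) → sumFrom f a n ≡ sumFrom g a n
  sum-cong a zero    f≗g = refl
  sum-cong a (suc n) f≗g = cong₂ _+_ (f≗g a) (sum-cong (suc a) n f≗g)

  sum-+ : ∀ f g a n → sumFrom (λ i → f i + g i) a n ≡ sumFrom f a n + sumFrom g a n
  sum-+ f g a zero    = refl
  sum-+ f g a (suc n) = trans (cong (f a + g a +_) (sum-+ f g (suc a) n)) (+-Comm.interchange (f a) (g a) _ _)

  sum-* : ∀ c f a n → sumFrom (λ i → c * f i) a n ≡ c * sumFrom f a n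
  sum-* c f a zero    = sym (ℕ.*-zeroʳ c)
  sum-* c f a (suc n) = trans (cong (c * f a +_) (sum-* c f (suc a) n)) (sym (ℕ.*-distribˡ-+ c (f a) _))

  sum-const : ∀ c a n → sumFrom (λ _ → c) a n ≡ n * c
  sum-const c a zero    = refl
  sum-const c a (suc n) = cong (c +_) (sum-const c (suc a) n)

  sum-shift : ∀ f c a n → sumFrom f (c + a) n ≡ sumFrom (λ i → f (c + i)) a n
  sum-shift f c a zero    = refl
  sum-shift f c a (suc n) =
    cong (f (c + a) +_) (trans (cong (λ b → sumFrom f b n) (sym (ℕ.+-suc c a))) (sum-shift f c (suc a) n))

  sum-last : ∀ f a n → sumFrom f a (suc n) ≡ sumFrom f a n + f (a + n)
  sum-last f a zero    = trans (ℕ.+-identityʳ (f a)) (cong f (sym (ℕ.+-identityʳ a)))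
  sum-last f a (suc n) = begin
    f a + sumFrom f (suc a) (suc n)           ≡⟨ cong (f a +_) (sum-last f (suc a) n) ⟩
    f a + (sumFrom f (suc a) n + f (suc a + n)) ≡⟨ sym (ℕ.+-assoc (f a) _ _) ⟩
    f a + sumFrom f (suc a) n + f (suc a + n)   ≡⟨ cong (λ b → f a + sumFrom f (suc a) n + f b) (sym (ℕ.+-suc a n)) ⟩
    f a + sumFrom f (suc a) n + f (a + suc n)   ∎

  sum-swap : ∀ (f : ℕ → ℕ → ℕ) a n b m →
             sumFrom (λ i → sumFrom (f i) b m) a n ≡ sumFrom (λ j → sumFrom (λ i → f i j) a n) b m
  sum-swap f a zero    b m = sym (trans (sum-const 0 b m) (ℕ.*-zeroʳ m))
  sum-swap f a (suc n) b m = trans (cong (sumFrom (f a) b m +_) (sum-swap f (suc a) n b m))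
                                   (sym (sum-+ (f a) (λ j → sumFrom (λ i → f i j) (suc a) n) b m))

module PowerSums where

  open Ranges
  open ≡-Reasoning

  semiring-^ : ∀ x n → x SemiringExp.^ n ≡ x ^ n
  semiring-^ x zero    = refl
  semiring-^ x (suc n) = cong (x *_) (semiring-^ x n)

  semiring-× : ∀ n x → n SemiringMult.× x ≡ n * x
  semiring-× zero    x = refl
  semiring-× (suc n) x = cong (x +_) (semiring-× n x)

  semiring-sum : ∀ n f → SemiringSum.sum {n} (λ i → f (toℕ i)) ≡ sumFrom f 0 n
  semiring-sum zero    f = refl
  semiring-sum (suc n) f = cong (f 0 +_) (trans (semiring-sum n (λ i → f (suc i))) (sym (sum-shift f 1 0 n)))

  binomial : ∀ m s → suc s ^ m ≡ sumFrom (λ j → (m C j) * s ^ j) 0 (suc m)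
  binomial m s = begin
    suc s ^ m                                                ≡⟨ cong (_^ m) (ℕ.+-comm 1 s) ⟩
    (s + 1) ^ m                                              ≡˘⟨ semiring-^ (s + 1) m ⟩
    (s + 1) SemiringExp.^ m                                  ≡⟨ Binomial.theorem m s 1 ⟩
    Binomial.binomialExpansion s 1 m                         ≡⟨ SemiringSum.sum-cong-≗ {suc m} term ⟩
    SemiringSum.sum {suc m} (λ j → (m C toℕ j) * s ^ toℕ j)  ≡⟨ semiring-sum (suc m) (λ j → (m C j) * s ^ j) ⟩
    sumFrom (λ j → (m C j) * s ^ j) 0 (suc m)                ∎
    where
    term : ∀ j → Binomial.binomialTerm s 1 m j ≡ (m C toℕ j) * s ^ toℕ j
    term j = let k = toℕ j in begin
      (m C k) SemiringMult.× (s SemiringExp.^ k * 1 SemiringExp.^ (m ∸ k))  ≡⟨ semiring-× (m C k) _ ⟩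
      (m C k) * (s SemiringExp.^ k * 1 SemiringExp.^ (m ∸ k))               ≡⟨ cong ((m C k) *_) (cong₂ _*_ (semiring-^ s k) (semiring-^ 1 (m ∸ k))) ⟩
      (m C k) * (s ^ k * 1 ^ (m ∸ k))                                       ≡⟨ cong (λ t → (m C k) * (s ^ k * t)) (ℕ.^-zeroˡ (m ∸ k)) ⟩
      (m C k) * (s ^ k * 1)                                                 ≡⟨ cong ((m C k) *_) (ℕ.*-identityʳ (s ^ k)) ⟩
      (m C k) * s ^ k                                                       ∎

  powerSum : ℕ → ℕ → ℕ
  powerSum p j = sumFrom (λ r → r ^ j) 0 p

  module _ (p : ℕ) where

    powerSum-binomial : ∀ n → sumFrom (λ r → suc r ^ n) 0 p ≡ sumFrom (λ j → (n C j) * powerSum p j) 0 (suc n)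
    powerSum-binomial n = begin
      sumFrom (λ r → suc r ^ n) 0 p                                     ≡⟨ sum-cong 0 p (binomial n) ⟩
      sumFrom (λ r → sumFrom (λ j → (n C j) * r ^ j) 0 (suc n)) 0 p     ≡⟨ sum-swap (λ r j → (n C j) * r ^ j) 0 p 0 (suc n) ⟩
      sumFrom (λ j → sumFrom (λ r → (n C j) * r ^ j) 0 p) 0 (suc n)     ≡⟨ sum-cong 0 (suc n) (λ j → sum-* (n C j) (λ r → r ^ j) 0 p) ⟩
      sumFrom (λ j → (n C j) * powerSum p j) 0 (suc n)                  ∎

    powerSum-shift : ∀ n → sumFrom (λ r → suc r ^ n) 0 p + 0 ^ n ≡ powerSum p n + p ^ n
    powerSum-shift n = begin
      sumFrom (λ r → suc r ^ n) 0 p + 0 ^ n   ≡⟨ ℕ.+-comm _ (0 ^ n) ⟩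
      0 ^ n + sumFrom (λ r → suc r ^ n) 0 p   ≡⟨ cong (0 ^ n +_) (sym (sum-shift (_^ n) 1 0 p)) ⟩
      sumFrom (_^ n) 0 (suc p)                ≡⟨ sum-last (_^ n) 0 p ⟩
      powerSum p n + p ^ n                    ∎

    powerSum-recurrence : ∀ n → sumFrom (λ j → (suc n C j) * powerSum p j) 0 (suc n) ≡ p ^ suc n
    powerSum-recurrence n = ℕ.+-cancelʳ-≡ σ _ _ (begin
      sumFrom term 0 (suc n) + σ                     ≡˘⟨ cong (sumFrom term 0 (suc n) +_) top-term ⟩
      sumFrom term 0 (suc n) + (suc n C suc n) * σ   ≡˘⟨ sum-last term 0 (suc n) ⟩
      sumFrom term 0 (suc (suc n))                   ≡˘⟨ powerSum-binomial (suc n) ⟩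
      sumFrom (λ r → suc r ^ suc n) 0 p              ≡˘⟨ ℕ.+-identityʳ _ ⟩
      sumFrom (λ r → suc r ^ suc n) 0 p + 0 ^ suc n  ≡⟨ powerSum-shift (suc n) ⟩
      σ + p ^ suc n                                  ≡⟨ ℕ.+-comm σ _ ⟩
      p ^ suc n + σ                                  ∎)
      where
      σ : ℕ
      σ = powerSum p (suc n)
      term : ℕ → ℕ
      term j = (suc n C j) * powerSum p j
      top-term : (suc n C suc n) * σ ≡ σ
      top-term = trans (cong (_* σ) (nCn≡1 (suc n))) (ℕ.*-identityˡ σ)

  ∣-sum : ∀ {d} g n → (∀ j → j < n → d ∣ g j) → d ∣ sumFrom g 0 n
  ∣-sum         g zero    _         = _ ∣0
  ∣-sum {d} g (suc n) d∣terms = subst (d ∣_) (sym (sum-last g 0 n))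
    (∣m∣n⇒∣m+n (∣-sum g n (λ j j<n → d∣terms j (ℕ.m<n⇒m<1+n j<n))) (d∣terms n (ℕ.n<1+n n)))

  [2+n]C[1+n]≡2+n : ∀ n → suc (suc n) C suc n ≡ suc (suc n)
  [2+n]C[1+n]≡2+n n = trans (nCk≡nC[n∸k] (ℕ.n≤1+n (suc n))) (trans (cong (suc (suc n) C_) (ℕ.m+n∸n≡m 1 (suc n))) (nC1≡n _))

  -- For a prime p and j + 1 < p, p divides ∑_{r<p} r^j: by strong induction on j,
  -- since in the recurrence all terms but C(j+1,j) σ_j = (j+1) σ_j are multiples of p,
  -- and p does not divide j + 1 < p.
  powerSum-divisible : ∀ {p} → Prime p → ∀ j → suc j < p → p ∣ powerSum p j
  powerSum-divisible {p} p-prime = <-rec _ divisible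
    where
    divisible : ∀ j → (∀ {i} → i < j → suc i < p → p ∣ powerSum p i) → suc j < p → p ∣ powerSum p j
    divisible zero    _  _    = subst (p ∣_) (sym (trans (sum-const 1 0 p) (ℕ.*-identityʳ p))) ∣-refl
    divisible (suc k) IH j<p = p∣σ[1+k]
      where
      term : ℕ → ℕ
      term i = (suc (suc k) C i) * powerSum p i
      p∣all : p ∣ sumFrom term 0 (suc k) + term (suc k)
      p∣all = subst (p ∣_) (trans (sym (powerSum-recurrence p (suc k))) (sum-last term 0 (suc k))) (∣m⇒∣m*n _ ∣-refl)
      p∣lower : p ∣ sumFrom term 0 (suc k)
      p∣lower = ∣-sum term (suc k) (λ i i<1+k → ∣n⇒∣m*n (suc (suc k) C i) (IH i<1+k (ℕ.<-trans (s≤s i<1+k) j<p)))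
      p∣[2+k]σ : p ∣ suc (suc k) * powerSum p (suc k)
      p∣[2+k]σ = subst (λ c → p ∣ c * powerSum p (suc k)) ([2+n]C[1+n]≡2+n k) (∣m+n∣m⇒∣n p∣all p∣lower)
      p∣σ[1+k] : p ∣ powerSum p (suc k)
      p∣σ[1+k] with euclidsLemma (suc (suc k)) (powerSum p (suc k)) p-prime p∣[2+k]σ
      ... | inj₂ p∣σ   = p∣σ
      ... | inj₁ p∣2+k = ⊥-elim (ℕ.<-irrefl refl (ℕ.<-≤-trans j<p (∣⇒≤ p∣2+k)))

  prod-^-binomial : ∀ (g : ℕ → ℕ) a n m → prodFrom (λ s → g s ^ (suc s ^ m)) a n
                              ≡ prodFrom (λ j → prodFrom (λ s → g s ^ (s ^ j)) a n ^ (m C j)) 0 (suc m)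
  prod-^-binomial g a n m = begin
    prodFrom (λ s → g s ^ (suc s ^ m)) a n                  ≡⟨ prod-cong a n expand ⟩
    prodFrom (λ s → prodFrom (term s) 0 (suc m)) a n        ≡⟨ prod-swap term a n 0 (suc m) ⟩
    prodFrom (λ j → prodFrom (λ s → term s j) a n) 0 (suc m) ≡⟨ prod-cong 0 (suc m) collect ⟩
    prodFrom (λ j → prodFrom (λ s → g s ^ (s ^ j)) a n ^ (m C j)) 0 (suc m) ∎
    where
    term : ℕ → ℕ → ℕ
    term s j = g s ^ ((m C j) * s ^ j)
    expand : ∀ s → g s ^ (suc s ^ m) ≡ prodFrom (term s) 0 (suc m)
    expand s = trans (cong (g s ^_) (binomial m s)) (sym (prod-^-sum (g s) (λ j → (m C j) * s ^ j) 0 (suc m)))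
    collect : ∀ j → prodFrom (λ s → term s j) a n ≡ prodFrom (λ s → g s ^ (s ^ j)) a n ^ (m C j)
    collect j = trans (prod-cong a n (λ s → trans (cong (g s ^_) (ℕ.*-comm (m C j) (s ^ j))) (sym (ℕ.^-*-assoc (g s) (s ^ j) (m C j)))))
                      (prod-^ (λ s → g s ^ (s ^ j)) (m C j) a n)

module ModuloPrime (K : ℕ) (N-prime : Prime (suc K)) where

  open Congruence
  open Ranges

  -- The prime modulus N = K + 1; K plays the role of -1.
  N : ℕ
  N = suc K

  Unit : ℕ → Set
  Unit x = ¬ (N ∣ x)

  unit-* : ∀ {a b} → Unit a → Unit b → Unit (a * b)
  unit-* {a} {b} N∤a N∤b N∣ab with euclidsLemma a b N-prime N∣ab
  ... | inj₁ N∣a = N∤a N∣a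
  ... | inj₂ N∣b = N∤b N∣b

  unit-< : ∀ {x} → 0 < x → x < N → Unit x
  unit-< {suc x} _ x<N = >⇒∤ x<N

  1<N : 1 < N
  1<N = nonTrivial⇒n>1 N {{prime⇒nonTrivial N-prime}}

  unit-1 : Unit 1
  unit-1 = unit-< (s≤s z≤n) 1<N

  unit-K : Unit K
  unit-K = unit-< (ℕ.≤-pred 1<N) (ℕ.n<1+n K)

  unit-^ : ∀ {a} e → Unit a → Unit (a ^ e)
  unit-^ zero    _   = unit-1
  unit-^ (suc e) N∤a = unit-* N∤a (unit-^ e N∤a)

  unit-! : ∀ {x} → x < N → Unit (x !)
  unit-! {zero}  _    = unit-1
  unit-! {suc x} x<N = unit-* (unit-< (s≤s z≤n) x<N) (unit-! (ℕ.<-trans (ℕ.n<1+n x) x<N))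

  unit-prod : ∀ {f} a n → (∀ k → k < n → Unit (f (a + k))) → Unit (prodFrom f a n)
  unit-prod         a zero    _     = unit-1
  unit-prod {f} a (suc n) units = unit-* (subst Unit (cong f (ℕ.+-identityʳ a)) (units 0 (s≤s z≤n)))
    (unit-prod (suc a) n (λ k k<n → subst Unit (cong f (ℕ.+-suc a k)) (units (suc k) (s≤s k<n))))

  unit-of-inverse : ∀ {a b} → a * b ≡ 1 mod N → Unit b
  unit-of-inverse {a} {b} ab≡1 N∣b = unit-1 (≡-mod-0⇒∣ (≡-mod-trans (≡-mod-sym ab≡1) ab≡0))
    where ab≡0 : a * b ≡ 0 mod N
          ab≡0 = subst (a * b ≡_mod N) (ℕ.*-zeroʳ a) (*-cong-mod (≡-mod-refl {a = a}) (∣⇒≡-mod-0 N∣b))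

  unit⇒coprime : ∀ {a} → Unit a → Coprime N a
  unit⇒coprime N∤a (d∣N , d∣a) with prime⇒irreducible N-prime d∣N
  ... | inj₁ d≡1    = d≡1
  ... | inj₂ refl   = ⊥-elim (N∤a d∣a)

  inverse : ∀ {a} → Unit a → Σ ℕ λ b → a * b ≡ 1 mod N
  inverse {a} N∤a with coprime-Bézout (unit⇒coprime N∤a)
  ... | Bézout.-+ x y 1+xN≡ya = y , subst (_≡ 1 mod N) (ℕ.*-comm y a) (≡-mod-by-multiples 0 x (trans (ℕ.+-identityʳ _) (sym 1+xN≡ya)))
  ... | Bézout.+- x y 1+ya≡xN = y * K , ≡-mod-trans ay[-1]≡[-1][-1] (square-of-predecessor K)
    where
    ya≡-1 : y * a ≡ K mod N
    ya≡-1 = ≡-mod-by-multiples 1 x (begin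
      y * a + 1 * N   ≡⟨ cong (y * a +_) (ℕ.*-identityˡ N) ⟩
      y * a + suc K   ≡⟨ ℕ.+-suc (y * a) K ⟩
      suc (y * a) + K ≡⟨ cong (_+ K) 1+ya≡xN ⟩
      x * N + K       ≡⟨ ℕ.+-comm (x * N) K ⟩
      K + x * N       ∎)
      where open ≡-Reasoning
    ay[-1]≡[-1][-1] : a * (y * K) ≡ K * K mod N
    ay[-1]≡[-1][-1] = subst (_≡ K * K mod N) (trans (cong (_* K) (ℕ.*-comm y a)) (ℕ.*-assoc a y K))
                        (*-cong-mod ya≡-1 (≡-mod-refl {a = K}))

  ≡-mod-≤ : ∀ {a b} → a ≤ b → b < N → b ≡ a mod N → b ≡ a
  ≡-mod-≤ {a} a≤b b<N b≡a with ℕ.m≤n⇒∃[o]m+o≡n a≤b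
  ... | zero  , refl = ℕ.+-identityʳ a
  ... | suc k , refl = ⊥-elim (>⇒∤ (ℕ.≤-<-trans (ℕ.m≤n+m (suc k) a) b<N) (+-≡-mod⇒∣ b≡a))

  ≡-mod-< : ∀ {a b} → a < N → b < N → a ≡ b mod N → a ≡ b
  ≡-mod-< {a} {b} a<N b<N a≡b with ℕ.≤-total a b
  ... | inj₁ a≤b = sym (≡-mod-≤ a≤b b<N (≡-mod-sym a≡b))
  ... | inj₂ b≤a = ≡-mod-≤ b≤a a<N a≡b

  %-≡-mod : ∀ b → b % N ≡ b mod N
  %-≡-mod b = ≡-mod-sym (subst (_≡ b % N mod N) (sym (m≡m%n+[m/n]*n b N)) (+-multiple (b % N) (b / N)))

  residue : Fin K → ℕ
  residue i = suc (toℕ i)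

  residue<N : ∀ i → residue i < N
  residue<N i = s≤s (Fin.toℕ<n i)

  indexOf : ∀ {b} → Unit b → Σ (Fin K) λ j → residue j ≡ b mod N
  indexOf {b} N∤b with b % N | m%n<n b N | %-≡-mod b
  ... | zero  | _   | 0≡b = ⊥-elim (N∤b (≡-mod-0⇒∣ (≡-mod-sym 0≡b)))
  ... | suc r | r<N | r≡b = fromℕ< (ℕ.≤-pred r<N) , subst (_≡ b mod N) (cong suc (sym (Fin.toℕ-fromℕ< _))) r≡b

  abstract
    inverseResidue : ∀ i → Σ (Fin K) λ j → residue i * residue j ≡ 1 mod N
    inverseResidue i with inverse (unit-< (s≤s z≤n) (residue<N i))
    ... | b , ib≡1 with indexOf (unit-of-inverse {a = residue i} ib≡1)
    ...   | j , j≡b = j , ≡-mod-trans (*-cong-mod (≡-mod-refl {a = residue i}) j≡b) ib≡1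

  inverseIndex : Fin K → Fin K
  inverseIndex i = proj₁ (inverseResidue i)

  inverseIndex-inverse : ∀ i → residue i * residue (inverseIndex i) ≡ 1 mod N
  inverseIndex-inverse i = proj₂ (inverseResidue i)

  inverseIndex-involutive : ∀ i → inverseIndex (inverseIndex i) ≡ i
  inverseIndex-involutive i = Fin.toℕ-injective (ℕ.suc-injective (≡-mod-< (residue<N k) (residue<N i) k≡i))
    where
    j k : Fin K
    j = inverseIndex i
    k = inverseIndex j
    k≡i : residue k ≡ residue i mod N
    k≡i = begin
      residue k                           ≡˘⟨ ℕ.*-identityˡ (residue k) ⟩
      1 * residue k                       ≈˘⟨ *-cong-mod (inverseIndex-inverse i) ≡-mod-refl ⟩
      residue i * residue j * residue k   ≡⟨ ℕ.*-assoc (residue i) (residue j) (residue k) ⟩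
      residue i * (residue j * residue k) ≈⟨ *-cong-mod (≡-mod-refl {a = residue i}) (inverseIndex-inverse j) ⟩
      residue i * 1                       ≡⟨ ℕ.*-identityʳ (residue i) ⟩
      residue i                           ∎
      where open ≡-mod-Reasoning N

  -- Wilson's theorem, squared: (K!)² ≡ 1 mod N.  Pairing every residue with its
  -- inverse, K!² = ∏ x · ∏ x⁻¹ = ∏ (x x⁻¹) ≡ 1, where ∏ x⁻¹ = ∏ x because
  -- inversion permutes the nonzero residues.
  wilson² : K ! * K ! ≡ 1 mod N
  wilson² = begin
    K ! * K !                                                      ≡⟨ cong₂ _*_ K!≡∏ K!≡∏ ⟩
    FinProduct.sum residue * FinProduct.sum residue                 ≡⟨ cong (FinProduct.sum residue *_) (FinProduct.sum-permute residue inversion) ⟩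
    FinProduct.sum residue * FinProduct.sum (residue ∘ inverseIndex) ≡˘⟨ FinProduct.∑-distrib-+ residue (residue ∘ inverseIndex) ⟩
    FinProduct.sum (λ i → residue i * residue (inverseIndex i))     ≈⟨ ∏-cong-mod _ (λ _ → 1) inverseIndex-inverse ⟩
    FinProduct.sum {K} (λ _ → 1)                                    ≡⟨ FinProduct.sum-replicate-zero K ⟩
    1                                                              ∎
    where
    open ≡-mod-Reasoning N
    inversion : Permutation′ K
    inversion = permutation inverseIndex inverseIndex inverseIndex-involutive inverseIndex-involutive
    K!≡∏ : K ! ≡ FinProduct.sum residue
    K!≡∏ = trans (sym (prod-identity≡! K)) (trans (prod-shift (λ k → k) 1 0 K) (prodFrom≡∏ suc K))

module PowerClasses (K : ℕ) (N-prime : Prime (suc K)) (p : ℕ) where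

  open Congruence
  open Ranges using (^-distribʳ-*)
  open ModuloPrime K N-prime

  -- x ≈ y: x and y represent the same class of F_N^× / (F_N^×)^p, i.e.
  -- x c^p ≡ y d^p (mod N) for some units c and d.
  infix 4 _≈_
  record _≈_ (x y : ℕ) : Set where
    constructor ≈-intro
    field
      {c d}    : ℕ
      c-unit   : Unit c
      d-unit   : Unit d
      equation : x * c ^ p ≡ y * d ^ p mod N

  *1^p : ∀ x → x * 1 ^ p ≡ x
  *1^p x = trans (cong (x *_) (ℕ.^-zeroˡ p)) (ℕ.*-identityʳ x)

  *^p*^p : ∀ x a b → x * a ^ p * b ^ p ≡ x * (a * b) ^ p
  *^p*^p x a b = trans (ℕ.*-assoc x _ _) (cong (x *_) (sym (^-distribʳ-* a b p)))

  ≡-mod⇒≈ : ∀ {x y} → x ≡ y mod N → x ≈ y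
  ≡-mod⇒≈ {x} {y} x≡y = ≈-intro unit-1 unit-1 (subst₂ (_≡_mod N) (sym (*1^p x)) (sym (*1^p y)) x≡y)

  ≡⇒≈ : ∀ {x y} → x ≡ y → x ≈ y
  ≡⇒≈ x≡y = ≡-mod⇒≈ (≡⇒≡-mod x≡y)

  ≈-refl : ∀ {x} → x ≈ x
  ≈-refl = ≡⇒≈ refl

  ≈-sym : ∀ {x y} → x ≈ y → y ≈ x
  ≈-sym (≈-intro c-unit d-unit eq) = ≈-intro d-unit c-unit (≡-mod-sym eq)

  ≈-trans : ∀ {x y z} → x ≈ y → y ≈ z → x ≈ z
  ≈-trans {x} {y} {z} (≈-intro {c} {d} c-unit d-unit eq) (≈-intro {c′} {d′} c′-unit d′-unit eq′) =
    ≈-intro (unit-* c-unit c′-unit) (unit-* d′-unit d-unit) (begin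
      x * (c * c′) ^ p     ≡˘⟨ *^p*^p x c c′ ⟩
      x * c ^ p * c′ ^ p   ≈⟨ *-cong-mod eq ≡-mod-refl ⟩
      y * d ^ p * c′ ^ p   ≡⟨ *-Comm.xy∙z≈xz∙y y (d ^ p) (c′ ^ p) ⟩
      y * c′ ^ p * d ^ p   ≈⟨ *-cong-mod eq′ ≡-mod-refl ⟩
      z * d′ ^ p * d ^ p   ≡⟨ *^p*^p z d′ d ⟩
      z * (d′ * d) ^ p     ∎)
    where open ≡-mod-Reasoning N

  ≈-setoid : Setoid 0ℓ 0ℓ
  ≈-setoid = record { Carrier = ℕ ; _≈_ = _≈_ ; isEquivalence = record { refl = ≈-refl ; sym = ≈-sym ; trans = ≈-trans } }

  module ≈-Reasoning = SetoidReasoning ≈-setoid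

  ≈-* : ∀ {x y x′ y′} → x ≈ y → x′ ≈ y′ → x * x′ ≈ y * y′
  ≈-* {x} {y} {x′} {y′} (≈-intro {c} {d} c-unit d-unit eq) (≈-intro {c′} {d′} c′-unit d′-unit eq′) =
    ≈-intro (unit-* c-unit c′-unit) (unit-* d-unit d′-unit) (begin
      x * x′ * (c * c′) ^ p       ≡⟨ regroup x x′ c c′ ⟩
      x * c ^ p * (x′ * c′ ^ p)   ≈⟨ *-cong-mod eq eq′ ⟩
      y * d ^ p * (y′ * d′ ^ p)   ≡˘⟨ regroup y y′ d d′ ⟩
      y * y′ * (d * d′) ^ p       ∎)
    where
    open ≡-mod-Reasoning N
    regroup : ∀ x x′ a b → x * x′ * (a * b) ^ p ≡ x * a ^ p * (x′ * b ^ p)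
    regroup x x′ a b = trans (cong (x * x′ *_) (^-distribʳ-* a b p)) (*-Comm.interchange x x′ (a ^ p) (b ^ p))

  ≈-^ : ∀ {x y} e → x ≈ y → x ^ e ≈ y ^ e
  ≈-^ zero    _   = ≈-refl
  ≈-^ (suc e) x≈y = ≈-* x≈y (≈-^ e x≈y)

  ≈1⇒^≈1 : ∀ {x} e → x ≈ 1 → x ^ e ≈ 1
  ≈1⇒^≈1 e x≈1 = ≈-trans (≈-^ e x≈1) (≡⇒≈ (ℕ.^-zeroˡ e))

  ^p≈1 : ∀ {x} → Unit x → x ^ p ≈ 1
  ^p≈1 {x} x-unit = ≈-intro unit-1 x-unit (≡⇒≡-mod (trans (*1^p (x ^ p)) (sym (ℕ.*-identityˡ (x ^ p)))))

  ^[k*p]≈1 : ∀ {x} k → Unit x → x ^ (k * p) ≈ 1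
  ^[k*p]≈1 {x} k x-unit = ≈-trans (≡⇒≈ (sym (ℕ.^-*-assoc x k p))) (^p≈1 (unit-^ k x-unit))

  ^[p^m]≈1 : ∀ {x} m → 0 < m → Unit x → x ^ (p ^ m) ≈ 1
  ^[p^m]≈1 {x} (suc m) _ x-unit = subst (λ e → x ^ e ≈ 1) (ℕ.*-comm (p ^ m) p) (^[k*p]≈1 (p ^ m) x-unit)

  ≈-cancel : ∀ {x y u} → Unit u → x * u ≈ y * u → x ≈ y
  ≈-cancel {x} {y} {u} u-unit xu≈yu with inverse u-unit
  ... | v , uv≡1 = begin
    x             ≡˘⟨ ℕ.*-identityʳ x ⟩
    x * 1         ≈˘⟨ ≡-mod⇒≈ (*-cong-mod (≡-mod-refl {a = x}) uv≡1) ⟩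
    x * (u * v)   ≡˘⟨ ℕ.*-assoc x u v ⟩
    x * u * v     ≈⟨ ≈-* xu≈yu (≈-refl {v}) ⟩
    y * u * v     ≡⟨ ℕ.*-assoc y u v ⟩
    y * (u * v)   ≈⟨ ≡-mod⇒≈ (*-cong-mod (≡-mod-refl {a = y}) uv≡1) ⟩
    y * 1         ≡⟨ ℕ.*-identityʳ y ⟩
    y             ∎
    where open ≈-Reasoning

  ^-≡-mod-p-≤ : ∀ {x a b} → Unit x → a ≤ b → b ≡ a mod p → x ^ b ≈ x ^ a
  ^-≡-mod-p-≤ {x} {a} x-unit a≤b b≡a with ℕ.m≤n⇒∃[o]m+o≡n a≤b
  ... | t , refl with +-≡-mod⇒∣ b≡a
  ... | divides k refl = begin
    x ^ (a + k * p)      ≡⟨ ℕ.^-distribˡ-+-* x a (k * p) ⟩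
    x ^ a * x ^ (k * p)  ≈⟨ ≈-* (≈-refl {x ^ a}) (^[k*p]≈1 k x-unit) ⟩
    x ^ a * 1            ≡⟨ ℕ.*-identityʳ (x ^ a) ⟩
    x ^ a                ∎
    where open ≈-Reasoning

  ^-≡-mod-p : ∀ {x a b} → Unit x → a ≡ b mod p → x ^ a ≈ x ^ b
  ^-≡-mod-p {x} {a} {b} x-unit a≡b with ℕ.≤-total a b
  ... | inj₁ a≤b = ≈-sym (^-≡-mod-p-≤ x-unit a≤b (≡-mod-sym a≡b))
  ... | inj₂ b≤a = ^-≡-mod-p-≤ x-unit b≤a a≡b

  odd⇒≡1+h*2 : ∀ {n} → ¬ 2 ∣ n → n ≡ suc (n / 2 * 2)
  odd⇒≡1+h*2 {n} 2∤n with n % 2 in n%2≡r | m%n<n n 2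
  ... | 0           | _             = ⊥-elim (2∤n (m%n≡0⇒n∣m n 2 n%2≡r))
  ... | 1           | _             = trans (m≡m%n+[m/n]*n n 2) (cong (_+ n / 2 * 2) n%2≡r)
  ... | suc (suc _) | s≤s (s≤s ())

  -- For odd p, a unit with trivial square is trivial: x ≈ x · x^p = (x · x)^((p+1)/2).
  square≈1⇒≈1 : ∀ {x} → ¬ 2 ∣ p → Unit x → x * x ≈ 1 → x ≈ 1
  square≈1⇒≈1 {x} 2∤p x-unit x²≈1 = begin
    x                        ≡˘⟨ ℕ.*-identityʳ x ⟩
    x * 1                    ≈˘⟨ ≈-* (≈-refl {x}) (^p≈1 x-unit) ⟩
    x ^ suc p                ≡⟨ cong (x ^_) (trans (cong suc (odd⇒≡1+h*2 2∤p)) (halve (p / 2))) ⟩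
    x ^ (suc h + suc h)      ≡⟨ ℕ.^-distribˡ-+-* x (suc h) (suc h) ⟩
    x ^ suc h * x ^ suc h    ≡˘⟨ ^-distribʳ-* x x (suc h) ⟩
    (x * x) ^ suc h          ≈⟨ ≈1⇒^≈1 (suc h) x²≈1 ⟩
    1                        ∎
    where
    open ≈-Reasoning
    h : ℕ
    h = p / 2
    halve : ∀ h → suc (suc (h * 2)) ≡ suc h + suc h
    halve = solve-∀

  ≈⇒EqModPthPowers : ∀ {x y} → x ≈ y → EqModPthPowers p N x y
  ≈⇒EqModPthPowers {x} {y} (≈-intro {c} {d} c-unit d-unit eq) with inverse d-unit
  ... | v , dv≡1 = c * v , unit-* c-unit (unit-of-inverse {a = d} dv≡1) , ≡-mod⇒CongMod (begin
    x * (c * v) ^ p      ≡˘⟨ *^p*^p x c v ⟩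
    x * c ^ p * v ^ p    ≈⟨ *-cong-mod eq ≡-mod-refl ⟩
    y * d ^ p * v ^ p    ≡⟨ *^p*^p y d v ⟩
    y * (d * v) ^ p      ≈⟨ *-cong-mod (≡-mod-refl {a = y}) (^-cong-mod p dv≡1) ⟩
    y * 1 ^ p            ≡⟨ *1^p y ⟩
    y                    ∎)
    where open ≡-mod-Reasoning N

  prod-≈ : ∀ {f g} a n → (∀ k → k < n → f (a + k) ≈ g (a + k)) → prodFrom f a n ≈ prodFrom g a n
  prod-≈             a zero    _     = ≈-refl
  prod-≈ {f} {g} a (suc n) f≈g = ≈-* (subst₂ _≈_ (cong f (ℕ.+-identityʳ a)) (cong g (ℕ.+-identityʳ a)) (f≈g 0 (s≤s z≤n)))
    (prod-≈ (suc a) n (λ k k<n → subst₂ _≈_ (cong f (ℕ.+-suc a k)) (cong g (ℕ.+-suc a k)) (f≈g (suc k) (s≤s k<n))))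

module Proposition (p₁ : ℕ) (p-prime : Prime (suc p₁)) (p-odd : ¬ 2 ∣ suc p₁)
                   (K : ℕ) (N-prime : Prime (suc K)) (M : ℕ) (K≡M*p : K ≡ M * suc p₁) where

  open Congruence
  open Ranges
  open PowerSums
  open ModuloPrime K N-prime
  open PowerClasses K N-prime (suc p₁)

  p : ℕ
  p = suc p₁

  F : ℕ → ℕ
  F r = (M * r) !

  M*r≤K : ∀ {r} → r ≤ p → M * r ≤ K
  M*r≤K {r} r≤p = subst (M * r ≤_) (sym K≡M*p) (ℕ.*-monoʳ-≤ M r≤p)

  F-unit : ∀ {r} → r ≤ p → Unit (F r)
  F-unit r≤p = unit-! (s≤s (M*r≤K r≤p))

  k<p₁⇒1+k≤p : ∀ {k} → k < p₁ → suc k ≤ p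
  k<p₁⇒1+k≤p k<p₁ = s≤s (ℕ.<⇒≤ k<p₁)

  S-unit : ∀ j → Unit (S p M j)
  S-unit j = unit-prod 1 p₁ (λ k k<p₁ → unit-^ (suc k ^ j) (F-unit (k<p₁⇒1+k≤p k<p₁)))

  -- K ≡ -1 is trivial in the quotient: (-1)² = 1 and p is odd.
  K≈1 : K ≈ 1
  K≈1 = square≈1⇒≈1 p-odd unit-K (≡-mod⇒≈ (square-of-predecessor K))

  -- F p = (N - 1)! is trivial in the quotient: its square is ≡ 1 by Wilson's theorem.
  F[p]≈1 : F p ≈ 1
  F[p]≈1 = subst (λ n → n ! ≈ 1) K≡M*p (square≈1⇒≈1 p-odd (unit-! (ℕ.n<1+n K)) (≡-mod⇒≈ wilson²))

  -- ∏_{q<L} (K - q) ≈ L!, since K - q ≡ (-1)(q + 1) and -1 ≈ 1.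
  falling≈! : ∀ L → L ≤ K → prodFrom (λ q → K ∸ q) 0 L ≈ L !
  falling≈! L L≤K = begin
    prodFrom (λ q → K ∸ q) 0 L   ≈⟨ prod-≈ 0 L (λ q q<L → K∸q≈1+q q (ℕ.≤-trans (ℕ.<⇒≤ q<L) L≤K)) ⟩
    prodFrom suc 0 L             ≡˘⟨ prod-shift (λ k → k) 1 0 L ⟩
    prodFrom (λ k → k) 1 L       ≡⟨ prod-identity≡! L ⟩
    L !                          ∎
    where
    open ≈-Reasoning
    K∸q≈1+q : ∀ q → q ≤ K → K ∸ q ≈ suc q
    K∸q≈1+q q q≤K = ≈-trans (≡-mod⇒≈ (∸≡*suc q≤K))
                      (≈-trans (≈-* K≈1 (≈-refl {suc q})) (≡⇒≈ (ℕ.*-identityˡ (suc q))))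

  -- F r · F(p - r) ≈ 1: with L = M(p - r) we have (M p)! = (M r)! ∏_{q<L} (K - q),
  -- and the falling factorial is ≈ L! = F(p - r).
  F-reflection : ∀ {r} → r ≤ p → F r * F (p ∸ r) ≈ 1
  F-reflection {r} r≤p = begin
    F r * L !                            ≈˘⟨ ≈-* (≈-refl {F r}) (falling≈! L L≤K) ⟩
    F r * prodFrom (λ q → K ∸ q) 0 L     ≡˘⟨ F[p]-split ⟩
    F p                                  ≈⟨ F[p]≈1 ⟩
    1                                    ∎
    where
    open ≈-Reasoning
    L : ℕ
    L = M * (p ∸ r)
    Mr+L≡K : M * r + L ≡ K
    Mr+L≡K = trans (cong (M * r +_) (ℕ.*-distribˡ-∸ M p r)) (trans (ℕ.m+[n∸m]≡n (ℕ.*-monoʳ-≤ M r≤p)) (sym K≡M*p))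
    L≤K : L ≤ K
    L≤K = subst (L ≤_) Mr+L≡K (ℕ.m≤n+m L (M * r))
    F[p]-split : F p ≡ F r * prodFrom (λ q → K ∸ q) 0 L
    F[p]-split = trans (cong _! (trans (sym K≡M*p) (sym Mr+L≡K)))
                       (trans (!-split (M * r) L) (cong (λ n → F r * prodFrom (λ q → n ∸ q) 0 L) Mr+L≡K))

  even⇒double : ∀ j → isEven j ≡ true → Σ ℕ λ i → j ≡ i + i
  even⇒double zero          _      = 0 , refl
  even⇒double (suc (suc j)) j-even with even⇒double j j-even
  ... | i , refl = suc i , cong suc (sym (ℕ.+-suc i i))

  -- For even j, (p - r)^j ≡ r^j (mod p), because (p - r)² ≡ r² (mod p).
  even-^-reflection : ∀ {j r} → isEven j ≡ true → r ≤ p → (p ∸ r) ^ j ≡ r ^ j mod p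
  even-^-reflection {j} {r} j-even r≤p with even⇒double j j-even
  ... | i , refl = subst₂ (_≡_mod p) (sym (double-exponent u i)) (sym (double-exponent r i)) (^-cong-mod i u²≡r²)
    where
    u : ℕ
    u = p ∸ r
    double-exponent : ∀ x i → x ^ (i + i) ≡ (x * x) ^ i
    double-exponent x i = trans (ℕ.^-distribˡ-+-* x i i) (sym (^-distribʳ-* x x i))
    expand : ∀ u r → u * u + r * (u + r) ≡ r * r + u * (u + r)
    expand = solve-∀
    u²≡r² : u * u ≡ r * r mod p
    u²≡r² = ≡-mod-by-multiples r u (subst (λ n → u * u + r * n ≡ r * r + u * n) (ℕ.m∸n+n≡m r≤p) (expand u r))

  -- For even j, S_j ≈ 1: reversing the order of the factors of S_j and using
  -- (p - r)^j ≡ r^j (mod p) gives S_j² ≈ ∏_r (F r · F(p - r))^{r^j} ≈ 1.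
  S-even≈1 : ∀ j → isEven j ≡ true → S p M j ≈ 1
  S-even≈1 j j-even = square≈1⇒≈1 p-odd (S-unit j) (begin
    Sⱼ * Sⱼ                                                ≡⟨ cong (Sⱼ *_) (prod-reverse (λ r → F r ^ (r ^ j)) p₁) ⟩
    Sⱼ * prodFrom (λ r → F (p ∸ r) ^ ((p ∸ r) ^ j)) 1 p₁   ≈⟨ ≈-* (≈-refl {Sⱼ}) (prod-≈ 1 p₁ reduce-exponent) ⟩
    Sⱼ * prodFrom (λ r → F (p ∸ r) ^ (r ^ j)) 1 p₁         ≡˘⟨ prod-* (λ r → F r ^ (r ^ j)) (λ r → F (p ∸ r) ^ (r ^ j)) 1 p₁ ⟩
    prodFrom (λ r → F r ^ (r ^ j) * F (p ∸ r) ^ (r ^ j)) 1 p₁ ≡˘⟨ prod-cong 1 p₁ (λ r → ^-distribʳ-* (F r) (F (p ∸ r)) (r ^ j)) ⟩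
    prodFrom (λ r → (F r * F (p ∸ r)) ^ (r ^ j)) 1 p₁      ≈⟨ prod-≈ 1 p₁ (λ k k<p₁ → ≈1⇒^≈1 (suc k ^ j) (F-reflection (k<p₁⇒1+k≤p k<p₁))) ⟩
    prodFrom (λ _ → 1) 1 p₁                                ≡⟨ prod-one 1 p₁ ⟩
    1                                                      ∎)
    where
    open ≈-Reasoning
    Sⱼ : ℕ
    Sⱼ = S p M j
    reduce-exponent : ∀ k → k < p₁ → F (p ∸ suc k) ^ ((p ∸ suc k) ^ j) ≈ F (p ∸ suc k) ^ (suc k ^ j)
    reduce-exponent k k<p₁ = ^-≡-mod-p (F-unit (ℕ.m∸n≤m p (suc k))) (even-^-reflection {j} j-even (k<p₁⇒1+k≤p k<p₁))

  -- P r = ∏_{q<M} (p q + r): for 1 ≤ r ≤ p, the product of the numbers in [1, N - 1]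
  -- that are ≡ r (mod p).
  P : ℕ → ℕ
  P r = prodFrom (λ q → p * q + r) 0 M

  p*q+r<N : ∀ {q r} → q < M → r ≤ p → p * q + r < N
  p*q+r<N {q} {r} q<M r≤p = s≤s (ℕ.≤-trans (ℕ.+-monoʳ-≤ (p * q) r≤p) p*q+p≤K)
    where
    p*q+p≤K : p * q + p ≤ K
    p*q+p≤K = subst₂ _≤_ (trans (ℕ.*-suc p q) (ℕ.+-comm p (p * q))) (trans (ℕ.*-comm p M) (sym K≡M*p)) (ℕ.*-monoʳ-≤ p q<M)

  unit-p*q+r : ∀ {q r} → q < M → 0 < r → r ≤ p → Unit (p * q + r)
  unit-p*q+r {q} {r} q<M 0<r r≤p = unit-< (ℕ.<-≤-trans 0<r (ℕ.m≤n+m r (p * q))) (p*q+r<N q<M r≤p)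

  -- Grouping 1, …, N - 1 by residue modulo p:  A_m ≈ ∏_{r=1}^{p-1} P(r)^{r^m}.
  -- Indeed k^{k^m} ≈ k^{r^m} for k ≡ r (mod p), and the class r = p only
  -- contributes the p-th power P(p)^{p^m}.
  A≈∏P : ∀ m → 0 < m → A N m ≈ prodFrom (λ r → P r ^ (r ^ m)) 1 p₁
  A≈∏P m 0<m = begin
    A N m                                                                ≡⟨⟩
    prodFrom f 1 K                                                       ≡⟨ cong (prodFrom f 1) K≡M*p ⟩
    prodFrom f 1 (M * p)                                                 ≡⟨ prod-blocks f 1 M p ⟩
    prodFrom (λ q → prodFrom f (1 + p * q) p) 0 M                        ≡⟨ prod-cong 0 M block ⟩
    prodFrom (λ q → prodFrom (λ r → f (p * q + r)) 1 p) 0 M              ≈⟨ prod-≈ 0 M reduce-exponents ⟩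
    prodFrom (λ q → prodFrom (λ r → (p * q + r) ^ (r ^ m)) 1 p) 0 M      ≡⟨ prod-swap (λ q r → (p * q + r) ^ (r ^ m)) 0 M 1 p ⟩
    prodFrom (λ r → prodFrom (λ q → (p * q + r) ^ (r ^ m)) 0 M) 1 p      ≡⟨ prod-cong 1 p (λ r → prod-^ (λ q → p * q + r) (r ^ m) 0 M) ⟩
    prodFrom g 1 p                                                       ≡⟨ prod-last g 1 p₁ ⟩
    prodFrom g 1 p₁ * P p ^ (p ^ m)                                      ≈⟨ ≈-* (≈-refl {prodFrom g 1 p₁}) (^[p^m]≈1 m 0<m P[p]-unit) ⟩
    prodFrom g 1 p₁ * 1                                                  ≡⟨ ℕ.*-identityʳ _ ⟩
    prodFrom g 1 p₁                                                      ∎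
    where
    open ≈-Reasoning
    f : ℕ → ℕ
    f k = k ^ (k ^ m)
    g : ℕ → ℕ
    g r = P r ^ (r ^ m)
    block : ∀ q → prodFrom f (1 + p * q) p ≡ prodFrom (λ r → f (p * q + r)) 1 p
    block q = trans (cong (λ a → prodFrom f a p) (ℕ.+-comm 1 (p * q))) (prod-shift f (p * q) 1 p)
    reduce-exponent : ∀ {q} → q < M → ∀ k → k < p → f (p * q + suc k) ≈ (p * q + suc k) ^ (suc k ^ m)
    reduce-exponent {q} q<M k k<p = ^-≡-mod-p (unit-p*q+r q<M (s≤s z≤n) k<p)
      (^-cong-mod m (subst (_≡ suc k mod p) (trans (cong (suc k +_) (ℕ.*-comm q p)) (ℕ.+-comm (suc k) (p * q)))
                                       (+-multiple (suc k) q)))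
    reduce-exponents : ∀ q → q < M → prodFrom (λ r → f (p * q + r)) 1 p ≈ prodFrom (λ r → (p * q + r) ^ (r ^ m)) 1 p
    reduce-exponents q q<M = prod-≈ {λ r → f (p * q + r)} {λ r → (p * q + r) ^ (r ^ m)} 1 p (reduce-exponent q<M)
    P[p]-unit : Unit (P p)
    P[p]-unit = unit-prod 0 M (λ q q<M → unit-p*q+r q<M (s≤s z≤n) ℕ.≤-refl)

  -- M(p q + r) = M r + q K ≡ M r - q (mod N) for 0 ≤ q < M ≤ M r.
  M*[p*q+r]≡M*r∸q : ∀ {q r} → q < M → 0 < r → M * (p * q + r) ≡ M * r ∸ q mod N
  M*[p*q+r]≡M*r∸q {q} {r} q<M 0<r = ≡-mod-sym (≡-mod-by-multiples q 0 (begin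
    M * r ∸ q + q * N            ≡⟨ cong (M * r ∸ q +_) (ℕ.*-suc q K) ⟩
    M * r ∸ q + (q + q * K)      ≡˘⟨ ℕ.+-assoc (M * r ∸ q) q (q * K) ⟩
    M * r ∸ q + q + q * K        ≡⟨ cong₂ _+_ (ℕ.m∸n+n≡m q≤M*r) (cong (q *_) K≡M*p) ⟩
    M * r + q * (M * p)          ≡⟨ expand M p q r ⟩
    M * (p * q + r)              ≡˘⟨ ℕ.+-identityʳ _ ⟩
    M * (p * q + r) + 0 * N      ∎))
    where
    open ≡-Reasoning
    q≤M*r : q ≤ M * r
    q≤M*r = ℕ.≤-trans (ℕ.<⇒≤ q<M) (ℕ.m≤m*n M r {{>-nonZero 0<r}})
    expand : ∀ M p q r → M * r + q * (M * p) ≡ M * (p * q + r)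
    expand = solve-∀

  -- M^M P(r + 1) F(r) ≈ F(r + 1): multiplying the factors of P(r + 1) by M gives
  -- ∏_{q<M} (M(r + 1) - q) = (M(r + 1))! / (M r)!.
  P-factorial : ∀ r → P (suc r) * (M ^ M * F r) ≈ F (suc r)
  P-factorial r = begin
    P (suc r) * (M ^ M * F r)                         ≡⟨ regroup ⟩
    prodFrom (λ q → M * (p * q + suc r)) 0 M * F r    ≈⟨ ≈-* (prod-≈ 0 M (λ q q<M → ≡-mod⇒≈ (M*[p*q+r]≡M*r∸q q<M (s≤s z≤n)))) (≈-refl {F r}) ⟩
    prodFrom (λ q → M * suc r ∸ q) 0 M * F r          ≡⟨ ℕ.*-comm _ (F r) ⟩
    F r * prodFrom (λ q → M * suc r ∸ q) 0 M          ≡⟨ cong (λ n → F r * prodFrom (λ q → n ∸ q) 0 M) M*[1+r] ⟩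
    F r * prodFrom (λ q → M * r + M ∸ q) 0 M          ≡˘⟨ !-split (M * r) M ⟩
    (M * r + M) !                                     ≡˘⟨ cong _! M*[1+r] ⟩
    F (suc r)                                         ∎
    where
    open ≈-Reasoning
    M*[1+r] : M * suc r ≡ M * r + M
    M*[1+r] = trans (ℕ.*-suc M r) (ℕ.+-comm M (M * r))
    regroup : P (suc r) * (M ^ M * F r) ≡ prodFrom (λ q → M * (p * q + suc r)) 0 M * F r
    regroup = trans (*-Comm.x∙yz≈yx∙z (P (suc r)) (M ^ M) (F r))
                    (cong (_* F r) (trans (cong (_* P (suc r)) (sym (prod-const M 0 M)))
                                          (sym (prod-* (λ _ → M) (λ q → p * q + suc r) 0 M))))

  unit-M : Unit M
  unit-M = unit-< 0<M (s≤s M≤K)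
    where
    0<M : 0 < M
    0<M = ℕ.n≢0⇒n>0 (λ M≡0 → unit-K (subst (N ∣_) (sym (trans K≡M*p (cong (_* p) M≡0))) (N ∣0)))
    M≤K : M ≤ K
    M≤K = subst (M ≤_) (sym K≡M*p) (ℕ.m≤m*n M p)

  p∣∑r^m : ∀ m → 0 < m → suc m < p → p ∣ sumFrom (λ r → r ^ m) 1 p₁
  p∣∑r^m (suc m) _ m+1<p = powerSum-divisible p-prime (suc m) m+1<p

  -- The factorials left over by P-factorial: G_m = ∏_{r=1}^{p-1} F(r - 1)^{r^m}.
  G : ℕ → ℕ
  G m = prodFrom (λ r → F (r ∸ 1) ^ (r ^ m)) 1 p₁

  -- ∏_r (M^M F(r - 1))^{r^m} ≈ G_m for 0 < m < p - 1: the extra factor is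
  -- ∏_r (M^M)^{r^m} = (M^M)^{∑_r r^m}, a p-th power since p divides the power sum.
  ∏[M^M*F]≈G : ∀ m → 0 < m → suc m < p → prodFrom (λ r → (M ^ M * F (r ∸ 1)) ^ (r ^ m)) 1 p₁ ≈ G m
  ∏[M^M*F]≈G m 0<m m+1<p with p∣∑r^m m 0<m m+1<p
  ... | divides t ∑≡t*p = begin
    prodFrom (λ r → (M ^ M * F (r ∸ 1)) ^ (r ^ m)) 1 p₁            ≡⟨ prod-cong 1 p₁ (λ r → ^-distribʳ-* (M ^ M) (F (r ∸ 1)) (r ^ m)) ⟩
    prodFrom (λ r → (M ^ M) ^ (r ^ m) * F (r ∸ 1) ^ (r ^ m)) 1 p₁  ≡⟨ prod-* (λ r → (M ^ M) ^ (r ^ m)) (λ r → F (r ∸ 1) ^ (r ^ m)) 1 p₁ ⟩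
    prodFrom (λ r → (M ^ M) ^ (r ^ m)) 1 p₁ * G m                 ≡⟨ cong (_* G m) (prod-^-sum (M ^ M) (λ r → r ^ m) 1 p₁) ⟩
    (M ^ M) ^ sumFrom (λ r → r ^ m) 1 p₁ * G m                    ≡⟨ cong (λ e → (M ^ M) ^ e * G m) ∑≡t*p ⟩
    (M ^ M) ^ (t * p) * G m                                       ≈⟨ ≈-* (^[k*p]≈1 t (unit-^ M unit-M)) (≈-refl {G m}) ⟩
    1 * G m                                                       ≡⟨ ℕ.*-identityˡ (G m) ⟩
    G m                                                           ∎
    where open ≈-Reasoning

  A*G≈S : ∀ m → 0 < m → suc m < p → A N m * G m ≈ S p M m
  A*G≈S m 0<m m+1<p = begin
    A N m * G m                                                  ≈⟨ ≈-* (A≈∏P m 0<m) (≈-sym (∏[M^M*F]≈G m 0<m m+1<p)) ⟩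
    prodFrom (λ r → P r ^ (r ^ m)) 1 p₁ * prodFrom (λ r → X r ^ (r ^ m)) 1 p₁
                                                                 ≡˘⟨ prod-* (λ r → P r ^ (r ^ m)) (λ r → X r ^ (r ^ m)) 1 p₁ ⟩
    prodFrom (λ r → P r ^ (r ^ m) * X r ^ (r ^ m)) 1 p₁          ≡˘⟨ prod-cong 1 p₁ (λ r → ^-distribʳ-* (P r) (X r) (r ^ m)) ⟩
    prodFrom (λ r → (P r * X r) ^ (r ^ m)) 1 p₁                  ≈⟨ prod-≈ 1 p₁ (λ k _ → ≈-^ (suc k ^ m) (P-factorial k)) ⟩
    S p M m                                                      ∎
    where
    open ≈-Reasoning
    X : ℕ → ℕ
    X r = M ^ M * F (r ∸ 1)

  -- G_m F(p - 1)^{p^m} = ∏_{s=0}^{p-1} F(s)^{(s+1)^m} = ∏_{j=0}^{m} S_j^{C(m,j)}, by the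
  -- binomial theorem in the exponent; F(0) = 1 and F(p - 1)^{p^m} is a p-th power.
  G≈∏S : ∀ m → 0 < m → G m ≈ prodFrom (λ j → S p M j ^ (m C j)) 0 (suc m)
  G≈∏S m 0<m = begin
    G m                                       ≡˘⟨ ℕ.*-identityʳ (G m) ⟩
    G m * 1                                   ≈˘⟨ ≈-* (≈-refl {G m}) (^[p^m]≈1 m 0<m (F-unit (ℕ.n≤1+n p₁))) ⟩
    G m * h p₁                                ≡⟨ cong (_* h p₁) (prod-shift (λ r → F (r ∸ 1) ^ (r ^ m)) 1 0 p₁) ⟩
    prodFrom h 0 p₁ * h p₁                    ≡˘⟨ prod-last h 0 p₁ ⟩
    h 0 * prodFrom h 1 p₁                     ≡⟨ cong (_* prodFrom h 1 p₁) h[0]≡1 ⟩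
    1 * prodFrom h 1 p₁                       ≡⟨ ℕ.*-identityˡ (prodFrom h 1 p₁) ⟩
    prodFrom h 1 p₁                           ≡⟨ prod-^-binomial F 1 p₁ m ⟩
    prodFrom (λ j → S p M j ^ (m C j)) 0 (suc m) ∎
    where
    open ≈-Reasoning
    h : ℕ → ℕ
    h s = F s ^ (suc s ^ m)
    h[0]≡1 : h 0 ≡ 1
    h[0]≡1 = trans (cong (λ n → (n !) ^ (1 ^ m)) (ℕ.*-zeroʳ M)) (ℕ.^-zeroˡ (1 ^ m))

  A*∏S≈1 : ∀ m → 0 < m → suc m < p → A N m * prodFrom (λ j → S p M j ^ (m C j)) 0 m ≈ 1
  A*∏S≈1 m 0<m m+1<p = ≈-cancel (S-unit m) (begin
    A N m * lower * Sₘ                        ≡⟨ ℕ.*-assoc (A N m) lower Sₘ ⟩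
    A N m * (lower * Sₘ)                      ≡˘⟨ cong (λ e → A N m * (lower * e)) Sₘ^C[m,m]≡Sₘ ⟩
    A N m * (lower * Sₘ ^ (m C m))            ≡˘⟨ cong (A N m *_) (prod-last (λ j → S p M j ^ (m C j)) 0 m) ⟩
    A N m * prodFrom (λ j → S p M j ^ (m C j)) 0 (suc m) ≈˘⟨ ≈-* (≈-refl {A N m}) (G≈∏S m 0<m) ⟩
    A N m * G m                               ≈⟨ A*G≈S m 0<m m+1<p ⟩
    Sₘ                                        ≡˘⟨ ℕ.*-identityˡ Sₘ ⟩
    1 * Sₘ                                    ∎)
    where
    open ≈-Reasoning
    Sₘ lower : ℕ
    Sₘ = S p M m
    lower = prodFrom (λ j → S p M j ^ (m C j)) 0 m
    Sₘ^C[m,m]≡Sₘ : Sₘ ^ (m C m) ≡ Sₘ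
    Sₘ^C[m,m]≡Sₘ = trans (cong (Sₘ ^_) (nCn≡1 m)) (ℕ.*-identityʳ Sₘ)

  ∏S≡posPart*negPart : ∀ m → prodFrom (λ j → S p M j ^ (suc m C j)) 1 m ≡ posPart p M (suc m) * negPart p M (suc m)
  ∏S≡posPart*negPart m = trans (prod-cong 1 m split) (prod-* _ _ 1 m)
    where
    split : ∀ j → S p M j ^ (suc m C j)
                ≡ (if isEven j then S p M j ^ (suc m C j) else 1) * (if isEven j then 1 else S p M j ^ (suc m C j))
    split j with isEven j
    ... | true  = sym (ℕ.*-identityʳ _)
    ... | false = sym (ℕ.*-identityˡ _)

  posPart≈1 : ∀ m → posPart p M m ≈ 1
  posPart≈1 m = ≈-trans (prod-≈ 1 (m ∸ 1) (λ k _ → even-factor≈1 (suc k))) (≡⇒≈ (prod-one 1 (m ∸ 1)))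
    where
    even-factor≈1 : ∀ j → (if isEven j then S p M j ^ (m C j) else 1) ≈ 1
    even-factor≈1 j with isEven j in j-even
    ... | true  = ≈1⇒^≈1 (m C j) (S-even≈1 j j-even)
    ... | false = ≈-refl

  A*negPart≈posPart : ∀ m → 0 < m → m < p₁ → A N m * negPart p M m ≈ posPart p M m
  A*negPart≈posPart (suc m) 0<m m<p₁ = begin
    A N (suc m) * neg                                              ≈˘⟨ ≈-* (≈-refl {A N (suc m)}) trivial-factors ⟩
    A N (suc m) * (S p M 0 * 1 * (pos * neg))                      ≡˘⟨ cong (λ e → A N (suc m) * (S p M 0 * 1 * e)) (∏S≡posPart*negPart m) ⟩
    A N (suc m) * prodFrom (λ j → S p M j ^ (suc m C j)) 0 (suc m) ≈⟨ A*∏S≈1 (suc m) 0<m (s≤s m<p₁) ⟩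
    1                                                              ≈˘⟨ posPart≈1 (suc m) ⟩
    pos                                                            ∎
    where
    open ≈-Reasoning
    pos neg : ℕ
    pos = posPart p M (suc m)
    neg = negPart p M (suc m)
    -- The factor S_0 = S_0^{C(m,0)} and the even part are trivial.
    trivial-factors : S p M 0 * 1 * (pos * neg) ≈ neg
    trivial-factors = begin
      S p M 0 * 1 * (pos * neg)  ≈⟨ ≈-* (≈-* (S-even≈1 0 refl) (≈-refl {1})) (≈-* (posPart≈1 (suc m)) (≈-refl {neg})) ⟩
      1 * 1 * (1 * neg)          ≡⟨ trans (ℕ.*-identityˡ (1 * neg)) (ℕ.*-identityˡ neg) ⟩
      neg                        ∎

odd-prime : ∀ {p} → Prime p → p ≢ 2 → ¬ 2 ∣ p
odd-prime p-prime p≢2 2∣p with prime⇒irreducible p-prime 2∣p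
... | inj₁ ()
... | inj₂ 2≡p = p≢2 (sym 2≡p)

proposition5p9 : (p N M m : ℕ) → Prime p → p ≢ 2 → Prime N → N ∸ 1 ≡ M * p
                 → 0 < m → m < p ∸ 1
                 → EqModPthPowers p N (A N m * negPart p M m) (posPart p M m)
proposition5p9 zero     _       _ _ p-prime _   _       = ⊥-elim (¬prime[0] p-prime)
proposition5p9 (suc p₁) zero    _ _ _       _   N-prime = ⊥-elim (¬prime[0] N-prime)
proposition5p9 (suc p₁) (suc K) M m p-prime p≢2 N-prime K≡M*p 0<m m<p₁ =
  PowerClasses.≈⇒EqModPthPowers K N-prime (suc p₁) (A*negPart≈posPart m 0<m m<p₁)
  where open Proposition p₁ p-prime (odd-prime p-prime p≢2) K N-prime M K≡M*p
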